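{- Let $(a,b,c)$ be the signature of a cubic girth-regular graph $\Gamma$ of girth $g$. Then: (1) $a+b+c$ is even; (2) $a+b\ge c$; and (3) if $a\ge 1$ and $c=a+b$, then $g$ is even.
   Context: Graphs are finite and simple; cubic means $3$-regular. For a graph of finite girth $g$, a girth cycle is a cycle of length $g$, and $\epsilon(e)$ is the number of girth cycles containing the edge $e$. The signature of a vertex $v$ with incident edges $e_1,\ldots,e_k$ ordered so that $\epsilon(e_1)\le\cdots\le\epsilon(e_k)$ is $(\epsilon(e_1),\ldots,\epsilon(e_k))$; a graph is girth-regular if all vertices have the same signature (the signature of the graph). -}

module Defs where

open import Data.Nat using (ℕ; zero; suc; _≤_)
open import Data.Nat.DivMod using (_mod_)
open import Data.Bool using (Bool; true; false; if_then_else_)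
open import Data.Fin using (Fin; toℕ)
open import Data.Vec using (Vec; lookup)
open import Data.List using (map; allFin)
open import Data.Nat.ListAction using (sum)
open import Data.Product using (Σ; Σ-syntax; ∃; ∃-syntax; _×_)
open import Data.Sum using (_⊎_)
open import Function.Bundles using (_↔_; _⇔_)
open import Function.Definitions using (Injective)
open import Relation.Binary.PropositionalEquality using (_≡_; _≢_)

record Graph (n : ℕ) : Set where
  field
    adj    : Fin n → Fin n → Bool
    sym    : ∀ x y → adj x y ≡ adj y x
    irrefl : ∀ x → adj x x ≡ false
open Graph public

deg : ∀ {n} → Graph n → Fin n → ℕ
deg {n} G v = sum (map (λ u → if adj G v u then 1 else 0) (allFin n))

Cubic : ∀ {n} → Graph n → Set
Cubic {n} G = ∀ (v : Fin n) → deg G v ≡ 3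

-- A set of edges, given as a (0/1) matrix with decidable equality, so that
-- distinct edge sets are distinct values and can be counted.
EdgeSet : ℕ → Set
EdgeSet n = Vec (Vec Bool n) n

_∈E_ : ∀ {n} → Fin n × Fin n → EdgeSet n → Set
_∈E_ {n} p S = lookup (lookup S (Data.Product.proj₁ p)) (Data.Product.proj₂ p) ≡ true

csuc : ∀ {k} → Fin k → Fin k
csuc {suc m} i = suc (toℕ i) mod suc m

-- {x,y} is an edge of the closed walk w(0) w(1) ... w(k-1) w(0)
Consec : ∀ {n k} → (Fin k → Fin n) → Fin n → Fin n → Set
Consec w x y = ∃[ i ] ((x ≡ w i × y ≡ w (csuc i)) ⊎ (y ≡ w i × x ≡ w (csuc i)))

IsCycle : ∀ {n} → Graph n → ℕ → EdgeSet n → Set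
IsCycle {n} G k S =
  (3 ≤ k) ×
  (Σ[ w ∈ (Fin k → Fin n) ]
     (Injective _≡_ _≡_ w ×
      (∀ i → adj G (w i) (w (csuc i)) ≡ true) ×
      (∀ x y → ((x , y) ∈E S) ⇔ Consec w x y)))
  where open Data.Product using (_,_)

IsGirth : ∀ {n} → Graph n → ℕ → Set
IsGirth {n} G g =
  (Σ[ S ∈ EdgeSet n ] IsCycle G g S) ×
  (∀ k (S : EdgeSet n) → IsCycle G k S → g ≤ k)

-- Girth cycles (cycles of length g) containing the edge {u,v}; the proofs
-- are irrelevant so that such an object is determined by its edge set.
record GirthCycleThrough {n} (G : Graph n) (g : ℕ) (u v : Fin n) : Set where
  constructor gct
  field
    edges    : EdgeSet n
    .isCycle : IsCycle G g edges
    .hasEdge : (u Data.Product., v) ∈E edges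

Eps : ∀ {n} → Graph n → ℕ → Fin n → Fin n → ℕ → Set
Eps G g u v N = Fin N ↔ GirthCycleThrough G g u v

HasSignature3 : ∀ {n} → Graph n → ℕ → Fin n → ℕ → ℕ → ℕ → Set
HasSignature3 {n} G g v a b c =
  (a ≤ b) × (b ≤ c) ×
  Σ[ x ∈ Fin n ] Σ[ y ∈ Fin n ] Σ[ z ∈ Fin n ]
    (x ≢ y × x ≢ z × y ≢ z ×
     adj G v x ≡ true × adj G v y ≡ true × adj G v z ≡ true ×
     Eps G g v x a × Eps G g v y b × Eps G g v z c)

GirthRegular3 : ∀ {n} → Graph n → ℕ → ℕ → ℕ → ℕ → Set
GirthRegular3 {n} G g a b c = ∀ (v : Fin n) → HasSignature3 G g v a b c

module Submission where

-- A cycle through a vertex v uses exactly two of the three edges at v.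
-- So if x, y, z are the neighbours of v and p, q, r count the girth cycles
-- through the edge pairs {vx,vy}, {vx,vz}, {vy,vz}, then
--     a = p + q,   b = p + r,   c = q + r,
-- which gives the first two claims at once.  If moreover c = a + b then p = 0,
-- and a ≥ 1 makes c the strict maximum, so the heavy edges (ε = c) form a
-- perfect matching and every girth cycle uses, at each of its vertices, the
-- heavy edge and one light edge.  Along a girth cycle heavy and light edges
-- therefore alternate, and g is even.

open import Defs hiding (sym)
open import Data.Bool as Bool using (Bool; true; false; not; if_then_else_)
open import Data.Bool.Properties using (not-involutive; ¬-not)
open import Data.Empty using (⊥; ⊥-elim)
open import Data.Fin using (Fin; zero; suc; toℕ; fromℕ; fromℕ<; inject₁; _≟_)
open import Data.Fin.Properties
  using (toℕ-injective; toℕ-fromℕ<; toℕ-fromℕ; toℕ-inject₁; toℕ<n; toℕ≤pred[n]; +↔⊎; ¬Fin0)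
open import Data.Fin.Permutation using (↔⇒≡)
open import Data.List using (tabulate)
open import Data.Vec using (lookup)
open import Data.List.Properties using (map-tabulate)
open import Data.Nat using (ℕ; zero; suc; _+_; _≤_; _<_; z≤n; s≤s; s≤s⁻¹)
open import Data.Nat.DivMod using (_%_; m<n⇒m%n≡m; n%n≡0)
open import Data.Nat.Divisibility using (_∣_; divides; ∣-refl; ∣m∣n⇒∣m+n)
open import Data.Nat.ListAction using (sum)
open import Data.Nat.Properties
  using ( +-commutativeSemigroup; +-monoʳ-≤; +-mono-≤; +-monoˡ-≤; +-cancelʳ-≡; m≤n+m; ≤-trans; ≤-<-trans
        ; <-irrefl; <-trans; n<1+n; m≤n⇒m<n∨m≡n; m+n≡0⇒m≡0; suc-injective)
open import Data.Nat.Solver using (module +-*-Solver)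
open import Algebra.Properties.CommutativeSemigroup +-commutativeSemigroup using (x∙yz≈y∙xz)
open import Data.Product using (Σ; ∃-syntax; _×_; _,_; proj₁) renaming (map to Σ-map)
open import Data.Product.Function.Dependent.Propositional using (Σ-↔)
open import Data.Sum using (_⊎_; inj₁; inj₂; [_,_])
open import Data.Sum.Function.Propositional using (_⊎-↔_)
open import Function.Base using (_∘_; id)
open import Function.Bundles using (_↔_; Inverse; mk↔ₛ′; Equivalence)
open import Function.Definitions using (Injective)
open import Function.Properties.Inverse using (↔-refl; ↔-sym; ↔-trans)
open import Axiom.UniquenessOfIdentityProofs using (module Decidable⇒UIP)
open import Relation.Nullary using (¬_; yes; no; does)
open import Relation.Nullary.Decidable using (recompute)
open import Relation.Binary.PropositionalEquality
  using (_≡_; _≢_; refl; sym; trans; cong; cong₂; subst)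

csuc-step : ∀ {m} (i : Fin (suc m)) → toℕ i < m → toℕ (csuc i) ≡ suc (toℕ i)
csuc-step i i<m = trans (toℕ-fromℕ< _) (m<n⇒m%n≡m (s≤s i<m))

csuc-wrap : ∀ {m} (i : Fin (suc m)) → toℕ i ≡ m → toℕ (csuc i) ≡ 0
csuc-wrap {m} i i≡m =
  trans (toℕ-fromℕ< _) (subst (λ t → suc t % suc m ≡ 0) (sym i≡m) (n%n≡0 (suc m)))

before-or-last : ∀ {m} (i : Fin (suc m)) → toℕ i < m ⊎ toℕ i ≡ m
before-or-last i = m≤n⇒m<n∨m≡n (toℕ≤pred[n] i)

csuc-injective : ∀ {m} (i j : Fin (suc m)) → csuc i ≡ csuc j → i ≡ j
csuc-injective i j eq with before-or-last i | before-or-last j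
... | inj₁ i<m | inj₁ j<m =
  toℕ-injective (suc-injective (trans (sym (csuc-step i i<m)) (trans (cong toℕ eq) (csuc-step j j<m))))
... | inj₁ i<m | inj₂ j≡m with () ← trans (sym (csuc-step i i<m)) (trans (cong toℕ eq) (csuc-wrap j j≡m))
... | inj₂ i≡m | inj₁ j<m with () ← trans (sym (csuc-wrap i i≡m)) (trans (cong toℕ eq) (csuc-step j j<m))
... | inj₂ i≡m | inj₂ j≡m = toℕ-injective (trans i≡m (sym j≡m))

cpred : ∀ {m} → Fin (suc m) → Fin (suc m)
cpred {m} zero = fromℕ m
cpred (suc i) = inject₁ i

csuc-cpred : ∀ {m} (i : Fin (suc m)) → csuc (cpred i) ≡ i
csuc-cpred {m} zero = toℕ-injective (csuc-wrap (fromℕ m) (toℕ-fromℕ m))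
csuc-cpred {suc m} (suc i) =
  toℕ-injective (trans (csuc-step (inject₁ i) i<m) (cong suc (toℕ-inject₁ i)))
  where
    i<m : toℕ (inject₁ i) < suc m
    i<m = subst (_< suc m) (sym (toℕ-inject₁ i)) (toℕ<n i)

csuc²≢id : ∀ {m} → 2 ≤ m → (i : Fin (suc m)) → csuc (csuc i) ≢ i
csuc²≢id {m} 2≤m i eq with before-or-last i
... | inj₂ i≡m = 1≢m (trans (sym two-steps) (trans (cong toℕ eq) i≡m))
  where
    one-step : toℕ (csuc i) ≡ 0
    one-step = csuc-wrap i i≡m
    two-steps : toℕ (csuc (csuc i)) ≡ 1
    two-steps =
      trans (csuc-step (csuc i) (subst (_< m) (sym one-step) (≤-trans (s≤s z≤n) 2≤m))) (cong suc one-step)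
    1≢m : 1 ≢ m
    1≢m 1≡m = <-irrefl refl (subst (2 ≤_) (sym 1≡m) 2≤m)
... | inj₁ i<m with before-or-last (csuc i)
...   | inj₁ ci<m = t≢2+t (sym (trans (sym two-steps) (cong toℕ eq)))
  where
    two-steps : toℕ (csuc (csuc i)) ≡ suc (suc (toℕ i))
    two-steps = trans (csuc-step (csuc i) ci<m) (cong suc (csuc-step i i<m))
    t≢2+t : ∀ {t} → t ≢ suc (suc t)
    t≢2+t ()
...   | inj₂ ci≡m = <-irrefl refl (subst (2 ≤_) m≡1 2≤m)
  where
    i≡0 : toℕ i ≡ 0
    i≡0 = trans (sym (cong toℕ eq)) (csuc-wrap (csuc i) ci≡m)
    m≡1 : m ≡ 1
    m≡1 = trans (sym ci≡m) (trans (csuc-step i i<m) (cong suc i≡0))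

consec-sym : ∀ {n k} {w : Fin k → Fin n} {u v} → Consec w u v → Consec w v u
consec-sym (i , inj₁ p) = i , inj₂ p
consec-sym (i , inj₂ p) = i , inj₁ p

consec-adj : ∀ {n k} (G : Graph n) {w : Fin k → Fin n} →
  (∀ i → adj G (w i) (w (csuc i)) ≡ true) → ∀ {u v} → Consec w u v → adj G u v ≡ true
consec-adj G w-adj (i , inj₁ (refl , refl)) = w-adj i
consec-adj G w-adj (i , inj₂ (refl , refl)) = trans (Graph.sym G _ _) (w-adj i)

module InjectiveWalk {n m : ℕ} (w : Fin (suc m) → Fin n) (w-injective : Injective _≡_ _≡_ w) where

  successor-unique : ∀ {v u u'} i j →
    v ≡ w i × u ≡ w (csuc i) → v ≡ w j × u' ≡ w (csuc j) → u ≡ u'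
  successor-unique i j (v≡wi , u≡) (v≡wj , u'≡) =
    trans u≡ (trans (cong (w ∘ csuc) (w-injective (trans (sym v≡wi) v≡wj))) (sym u'≡))

  predecessor-unique : ∀ {v u u'} i j →
    u ≡ w i × v ≡ w (csuc i) → u' ≡ w j × v ≡ w (csuc j) → u ≡ u'
  predecessor-unique i j (u≡ , v≡wci) (u'≡ , v≡wcj) =
    trans u≡ (trans (cong w (csuc-injective i j (w-injective (trans (sym v≡wci) v≡wcj)))) (sym u'≡))

  -- Of three walk-neighbours of v, two are reached in the same direction.
  no-three-neighbours : ∀ {v u₁ u₂ u₃} → Consec w v u₁ → Consec w v u₂ → Consec w v u₃ →
    u₁ ≢ u₂ → u₁ ≢ u₃ → u₂ ≢ u₃ → ⊥
  no-three-neighbours (i , inj₁ p) (j , inj₁ q) _ ne₁₂ _ _ = ne₁₂ (successor-unique i j p q)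
  no-three-neighbours (i , inj₂ p) (j , inj₂ q) _ ne₁₂ _ _ = ne₁₂ (predecessor-unique i j p q)
  no-three-neighbours (i , inj₁ p) (_ , inj₂ q) (k , inj₁ r) _ ne₁₃ _ = ne₁₃ (successor-unique i k p r)
  no-three-neighbours (_ , inj₁ _) (j , inj₂ q) (k , inj₂ r) _ _ ne₂₃ = ne₂₃ (predecessor-unique j k q r)
  no-three-neighbours (_ , inj₂ _) (j , inj₁ q) (k , inj₁ r) _ _ ne₂₃ = ne₂₃ (successor-unique j k q r)
  no-three-neighbours (i , inj₂ p) (_ , inj₁ _) (k , inj₂ r) _ ne₁₃ _ = ne₁₃ (predecessor-unique i k p r)

  second-neighbour : 2 ≤ m → ∀ {v u} → Consec w v u → ∃[ u' ] (u' ≢ u × Consec w v u')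
  second-neighbour 2≤m {u = u} (i , inj₁ (v≡wi , u≡wci)) =
    w (cpred i) , ne , cpred i , inj₂ (refl , trans v≡wi (cong w (sym (csuc-cpred i))))
    where
      ne : w (cpred i) ≢ u
      ne eq = csuc²≢id 2≤m (cpred i) (trans (cong csuc (csuc-cpred i)) (sym (w-injective (trans eq u≡wci))))
  second-neighbour 2≤m {u = u} (i , inj₂ (u≡wi , v≡wci)) =
    w (csuc (csuc i)) , ne , csuc i , inj₁ (v≡wci , refl)
    where
      ne : w (csuc (csuc i)) ≢ u
      ne eq = csuc²≢id 2≤m i (w-injective (trans eq u≡wi))

module _ {n} (G : Graph n) {k : ℕ} where

  cycle-edge-sym : ∀ S → IsCycle G k S → ∀ {u v} → (u , v) ∈E S → (v , u) ∈E S
  cycle-edge-sym S (_ , w , _ , _ , edges) {u} {v} uv =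
    Equivalence.from (edges v u) (consec-sym (Equivalence.to (edges u v) uv))

  cycle-edge-adj : ∀ S → IsCycle G k S → ∀ {u v} → (u , v) ∈E S → adj G u v ≡ true
  cycle-edge-adj S (_ , w , _ , w-adj , edges) {u} {v} uv = consec-adj G w-adj (Equivalence.to (edges u v) uv)

  cycle-no-three-edges : ∀ S → IsCycle G k S → ∀ {v u₁ u₂ u₃} → u₁ ≢ u₂ → u₁ ≢ u₃ → u₂ ≢ u₃ →
    (v , u₁) ∈E S → (v , u₂) ∈E S → (v , u₃) ∈E S → ⊥
  cycle-no-three-edges S (s≤s (s≤s (s≤s _)) , w , w-inj , _ , edges) {v} {u₁} {u₂} {u₃} ne₁₂ ne₁₃ ne₂₃ e₁ e₂ e₃ =
    InjectiveWalk.no-three-neighbours w w-inj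
      (Equivalence.to (edges v u₁) e₁) (Equivalence.to (edges v u₂) e₂) (Equivalence.to (edges v u₃) e₃)
      ne₁₂ ne₁₃ ne₂₃

  cycle-second-edge : ∀ S → IsCycle G k S → ∀ {v u} → (v , u) ∈E S → ∃[ u' ] (u' ≢ u × (v , u') ∈E S)
  cycle-second-edge S (s≤s (s≤s (s≤s _)) , w , w-inj , _ , edges) {v} {u} vu
    with InjectiveWalk.second-neighbour w w-inj (s≤s (s≤s z≤n)) (Equivalence.to (edges v u) vu)
  ... | u' , u'≢u , vu' = u' , u'≢u , Equivalence.from (edges v u') vu'

vertex-on : ∀ {n} (G : Graph n) {k} S → IsCycle G k S → Fin n
vertex-on G S (s≤s _ , w , _) = w zero

sumFin : ∀ {n} → (Fin n → ℕ) → ℕ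
sumFin f = sum (tabulate f)

zeroAt : ∀ {n} → Fin n → (Fin n → ℕ) → Fin n → ℕ
zeroAt zero    f zero    = 0
zeroAt zero    f (suc i) = f (suc i)
zeroAt (suc p) f zero    = f zero
zeroAt (suc p) f (suc i) = zeroAt p (f ∘ suc) i

zeroAt-other : ∀ {n} (p i : Fin n) (f : Fin n → ℕ) → p ≢ i → zeroAt p f i ≡ f i
zeroAt-other zero    zero    f p≢i = ⊥-elim (p≢i refl)
zeroAt-other zero    (suc i) f p≢i = refl
zeroAt-other (suc p) zero    f p≢i = refl
zeroAt-other (suc p) (suc i) f p≢i = zeroAt-other p i (f ∘ suc) (p≢i ∘ cong suc)

sum-zeroAt : ∀ {n} (p : Fin n) (f : Fin n → ℕ) → sumFin f ≡ f p + sumFin (zeroAt p f)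
sum-zeroAt zero    f = refl
sum-zeroAt (suc p) f =
  trans (cong (f zero +_) (sum-zeroAt p (f ∘ suc))) (x∙yz≈y∙xz (f zero) (f (suc p)) _)

sum-split-≤ : ∀ {n} (f : Fin n → ℕ) (p : Fin n) {k l} → f p ≡ k → l ≤ sumFin (zeroAt p f) → k + l ≤ sumFin f
sum-split-≤ f p refl l≤ = subst (_ ≤_) (sym (sum-zeroAt p f)) (+-monoʳ-≤ (f p) l≤)

four-ones≤sum : ∀ {n} (f : Fin n → ℕ) {x y z u} →
  x ≢ y → x ≢ z → y ≢ z → x ≢ u → y ≢ u → z ≢ u →
  f x ≡ 1 → f y ≡ 1 → f z ≡ 1 → f u ≡ 1 → 4 ≤ sumFin f
four-ones≤sum f {x} {y} {z} {u} x≢y x≢z y≢z x≢u y≢u z≢u fx fy fz fu =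
  sum-split-≤ f x fx
    (sum-split-≤ f₁ y (trans (zeroAt-other x y f x≢y) fy)
      (sum-split-≤ f₂ z (trans (zeroAt-other y z f₁ y≢z) (trans (zeroAt-other x z f x≢z) fz))
        (sum-split-≤ f₃ u
          (trans (zeroAt-other z u f₂ z≢u) (trans (zeroAt-other y u f₁ y≢u) (trans (zeroAt-other x u f x≢u) fu)))
          z≤n)))
  where
    f₁ f₂ f₃ : Fin _ → ℕ
    f₁ = zeroAt x f
    f₂ = zeroAt y f₁
    f₃ = zeroAt z f₂

record Claw {n} (G : Graph n) (v : Fin n) : Set where
  field
    x y z : Fin n
    x≢y : x ≢ y
    x≢z : x ≢ z
    y≢z : y ≢ z
    v~x : adj G v x ≡ true
    v~y : adj G v y ≡ true
    v~z : adj G v z ≡ true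

claw-yxz claw-zxy : ∀ {n} {G : Graph n} {v} → Claw G v → Claw G v
claw-yxz K = record { x = y ; y = x ; z = z ; x≢y = x≢y ∘ sym ; x≢z = y≢z ; y≢z = x≢z
                    ; v~x = v~y ; v~y = v~x ; v~z = v~z }
  where open Claw K
claw-zxy K = record { x = z ; y = x ; z = y ; x≢y = x≢z ∘ sym ; x≢z = y≢z ∘ sym ; y≢z = x≢y
                    ; v~x = v~z ; v~y = v~x ; v~z = v~y }
  where open Claw K

claw-complete : ∀ {n} {G : Graph n} {v} → deg G v ≡ 3 → (K : Claw G v) → ∀ {u} →
  adj G v u ≡ true → u ≡ Claw.x K ⊎ u ≡ Claw.y K ⊎ u ≡ Claw.z K
claw-complete {n} {G} {v} deg≡3 K {u} v~u with u ≟ Claw.x K | u ≟ Claw.y K | u ≟ Claw.z K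
... | yes u≡x | _       | _       = inj₁ u≡x
... | no _    | yes u≡y | _       = inj₂ (inj₁ u≡y)
... | no _    | no _    | yes u≡z = inj₂ (inj₂ u≡z)
... | no u≢x  | no u≢y  | no u≢z  = ⊥-elim (<-irrefl refl (subst (4 ≤_) deg≡3 four≤deg))
  where
    open Claw K
    indicator : Fin n → ℕ
    indicator w = if adj G v w then 1 else 0
    one : ∀ {w} → adj G v w ≡ true → indicator w ≡ 1
    one v~w rewrite v~w = refl
    four≤deg : 4 ≤ deg G v
    four≤deg = subst (4 ≤_) (sym (cong sum (map-tabulate id indicator)))
      (four-ones≤sum indicator x≢y x≢z y≢z (u≢x ∘ sym) (u≢y ∘ sym) (u≢z ∘ sym)
                     (one v~x) (one v~y) (one v~z) (one v~u))

Fiber : {A : Set} → (A → Bool) → Bool → Set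
Fiber {A} p b = Σ A (λ x → p x ≡ b)

fiber-≡ : ∀ {A : Set} {p : A → Bool} {b} {x x'} {e : p x ≡ b} {e' : p x' ≡ b} →
  x ≡ x' → _≡_ {A = Fiber p b} (x , e) (x' , e')
fiber-≡ refl = cong (_ ,_) (Decidable⇒UIP.≡-irrelevant Bool._≟_ _ _)

fin-fiber : ∀ a (q : Fin a → Bool) b → ∃[ m ] (Fin m ↔ Fiber q b)
fin-fiber zero q b = 0 , mk↔ₛ′ (λ ()) (λ { (() , _) }) (λ { (() , _) }) (λ ())
fin-fiber (suc a) q b with fin-fiber a (q ∘ suc) b | q zero Bool.≟ b
... | m , e | yes q0≡b = suc m , mk↔ₛ′ to from to∘from from∘to
  where
    open Inverse e using (strictlyInverseˡ; strictlyInverseʳ)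
    to : Fin (suc m) → Fiber q b
    to zero    = zero , q0≡b
    to (suc j) = Σ-map suc id (Inverse.to e j)
    from : Fiber q b → Fin (suc m)
    from (zero , _)  = zero
    from (suc i , r) = suc (Inverse.from e (i , r))
    to∘from : ∀ y → to (from y) ≡ y
    to∘from (zero , _)  = fiber-≡ refl
    to∘from (suc i , r) = cong (Σ-map suc id) (strictlyInverseˡ (i , r))
    from∘to : ∀ x → from (to x) ≡ x
    from∘to zero    = refl
    from∘to (suc j) = cong suc (strictlyInverseʳ j)
... | m , e | no q0≢b = m , mk↔ₛ′ to from to∘from strictlyInverseʳ
  where
    open Inverse e using (strictlyInverseˡ; strictlyInverseʳ)
    to : Fin m → Fiber q b
    to j = Σ-map suc id (Inverse.to e j)
    from : Fiber q b → Fin m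
    from (zero , r)  = ⊥-elim (q0≢b r)
    from (suc i , r) = Inverse.from e (i , r)
    to∘from : ∀ y → to (from y) ≡ y
    to∘from (zero , r)  = ⊥-elim (q0≢b r)
    to∘from (suc i , r) = cong (Σ-map suc id) (strictlyInverseˡ (i , r))

finite-fiber : ∀ {A : Set} {a} → Fin a ↔ A → (p : A → Bool) (b : Bool) → ∃[ m ] (Fin m ↔ Fiber p b)
finite-fiber {a = a} e p b with fin-fiber a (p ∘ Inverse.to e) b
... | m , f = m , ↔-trans f (Σ-↔ e ↔-refl)

fiber-partition : ∀ {A : Set} (p : A → Bool) → A ↔ (Fiber p true ⊎ Fiber p false)
fiber-partition {A} p = mk↔ₛ′ to from to∘from from∘to
  where
    classify : ∀ x b → p x ≡ b → Fiber p true ⊎ Fiber p false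
    classify x true  e = inj₁ (x , e)
    classify x false e = inj₂ (x , e)
    to : A → Fiber p true ⊎ Fiber p false
    to x = classify x (p x) refl
    from : Fiber p true ⊎ Fiber p false → A
    from (inj₁ (x , _)) = x
    from (inj₂ (x , _)) = x
    from∘classify : ∀ x b (e : p x ≡ b) → from (classify x b e) ≡ x
    from∘classify x true  e = refl
    from∘classify x false e = refl
    from∘to : ∀ x → from (to x) ≡ x
    from∘to x = from∘classify x (p x) refl
    classify-true : ∀ x b (e : p x ≡ b) (r : p x ≡ true) → classify x b e ≡ inj₁ (x , r)
    classify-true x true  e r = cong inj₁ (fiber-≡ refl)
    classify-true x false e r with () ← trans (sym e) r
    classify-false : ∀ x b (e : p x ≡ b) (r : p x ≡ false) → classify x b e ≡ inj₂ (x , r)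
    classify-false x false e r = cong inj₂ (fiber-≡ refl)
    classify-false x true  e r with () ← trans (sym e) r
    to∘from : ∀ y → to (from y) ≡ y
    to∘from (inj₁ (x , r)) = classify-true x (p x) refl r
    to∘from (inj₂ (x , r)) = classify-false x (p x) refl r

fiber-cong : ∀ {A : Set} (p q : A → Bool) bp bq →
  (∀ x → p x ≡ bp → q x ≡ bq) → (∀ x → q x ≡ bq → p x ≡ bp) → Fiber p bp ↔ Fiber q bq
fiber-cong p q bp bq p⇒q q⇒p =
  mk↔ₛ′ (λ (x , r) → x , p⇒q x r) (λ (x , r) → x , q⇒p x r) (λ _ → fiber-≡ refl) (λ _ → fiber-≡ refl)

card-unique : ∀ {P : Set} {m k} → Fin m ↔ P → Fin k ↔ P → m ≡ k
card-unique em ek = ↔⇒≡ (↔-trans em (↔-sym ek))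

card-⊎ : ∀ {P Q : Set} {a m k} → Fin a ↔ (P ⊎ Q) → Fin m ↔ P → Fin k ↔ Q → a ≡ m + k
card-⊎ {m = m} {k} e em ek = ↔⇒≡ (↔-trans e (↔-trans (↔-sym em ⊎-↔ ↔-sym ek) (↔-sym (+↔⊎ {m} {k}))))

-- Membership of an edge in an edge set as a Boolean, so that it can be counted.
edgeBit : ∀ {n} → EdgeSet n → Fin n → Fin n → Bool
edgeBit S x y = lookup (lookup S x) y

recompute-bool : ∀ {b b' : Bool} → .(b ≡ b') → b ≡ b'
recompute-bool {b} {b'} = recompute (b Bool.≟ b')

-- ε is well defined on undirected edges: girth cycles through uv and vu coincide.
through-sym : ∀ {n} (G : Graph n) g u v → GirthCycleThrough G g u v ↔ GirthCycleThrough G g v u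
through-sym G g u v = mk↔ₛ′ flip flip (λ { (gct _ _ _) → refl }) (λ { (gct _ _ _) → refl })
  where
    flip : ∀ {u v} → GirthCycleThrough G g u v → GirthCycleThrough G g v u
    flip (gct S C uv) = gct S C (cycle-edge-sym G S C uv)

eps-flip : ∀ {n} {G : Graph n} {g u v k} → Eps G g u v k → Eps G g v u k
eps-flip {G = G} {g} {u} {v} ε = ↔-trans ε (through-sym G g u v)

record PairCounts (a b c : ℕ) (P : Set) : Set where
  field
    p q r : ℕ
    a≡p+q : a ≡ p + q
    b≡p+r : b ≡ p + r
    c≡q+r : c ≡ q + r
    count-p : Fin p ↔ P

module Star {n} (G : Graph n) (g : ℕ) (v : Fin n) (deg≡3 : deg G v ≡ 3) where

  Through : Fin n → Set
  Through u = GirthCycleThrough G g v u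

  uses : ∀ {u} → Fin n → Through u → Bool
  uses u' C = edgeBit (GirthCycleThrough.edges C) v u'

  Pair : Fin n → Fin n → Set
  Pair u u' = Fiber {Through u} (uses u') true

  pair-sym : ∀ {u u'} → Pair u u' ↔ Pair u' u
  pair-sym = mk↔ₛ′ swap swap (λ { (gct _ _ _ , _) → fiber-≡ refl }) (λ { (gct _ _ _ , _) → fiber-≡ refl })
    where
      swap : ∀ {u u'} → Pair u u' → Pair u' u
      swap {u} (gct S C vu , vu') = gct S C vu' , recompute-bool vu

  -- A cycle through vx passes through exactly one of vy, vz: through vz when
  -- it avoids vy (it has a second edge at v), and not through vy when it uses
  -- vz (it has at most two edges at v).
  avoids-y⇒uses-z : (K : Claw G v) → let open Claw K in ∀ {k} S → IsCycle G k S →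
    (v , x) ∈E S → edgeBit S v y ≡ false → (v , z) ∈E S
  avoids-y⇒uses-z K S C vx ¬vy = other-edge (cycle-second-edge G S C vx)
    where
      open Claw K
      other-edge : ∃[ u ] (u ≢ x × (v , u) ∈E S) → (v , z) ∈E S
      other-edge (u , u≢x , vu) with claw-complete deg≡3 K (cycle-edge-adj G S C vu)
      ... | inj₁ u≡x          = ⊥-elim (u≢x u≡x)
      ... | inj₂ (inj₁ refl) with () ← trans (sym ¬vy) vu
      ... | inj₂ (inj₂ refl) = vu

  uses-z⇒avoids-y : (K : Claw G v) → let open Claw K in ∀ {k} S → IsCycle G k S →
    (v , x) ∈E S → (v , z) ∈E S → edgeBit S v y ≡ false
  uses-z⇒avoids-y K S C vx vz = ¬-not (λ vy → cycle-no-three-edges G S C x≢y x≢z y≢z vx vy vz)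
    where open Claw K

  through-splits : (K : Claw G v) → let open Claw K in Through x ↔ (Pair x y ⊎ Pair x z)
  through-splits K = ↔-trans (fiber-partition (uses y)) (↔-refl ⊎-↔ fiber-cong _ _ false true avoids-y uses-z)
    where
      open Claw K
      avoids-y : ∀ C → uses y C ≡ false → uses z C ≡ true
      avoids-y (gct S C vx) ¬vy = recompute-bool (avoids-y⇒uses-z K S C vx ¬vy)
      uses-z : ∀ C → uses z C ≡ true → uses y C ≡ false
      uses-z (gct S C vx) vz = recompute-bool (uses-z⇒avoids-y K S C vx vz)

  local-counts : (K : Claw G v) → let open Claw K in ∀ {a b c} →
    Eps G g v x a → Eps G g v y b → Eps G g v z c → PairCounts a b c (Pair x y)
  local-counts K εx εy εz
    with finite-fiber εx (uses (Claw.y K)) true | finite-fiber εx (uses (Claw.z K)) true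
       | finite-fiber εy (uses (Claw.z K)) true | finite-fiber εy (uses (Claw.x K)) true
       | finite-fiber εz (uses (Claw.x K)) true | finite-fiber εz (uses (Claw.y K)) true
  ... | p , Pxy | q , Pxz | r , Pyz | _ , Pyx | _ , Pzx | _ , Pzy = record
    { p = p ; q = q ; r = r
    ; a≡p+q = card-⊎ (↔-trans εx (through-splits K)) Pxy Pxz
    ; b≡p+r = trans (card-⊎ (↔-trans εy (through-splits (claw-yxz K))) Pyx Pyz)
                    (cong (_+ r) (card-unique Pyx (↔-trans Pxy pair-sym)))
    ; c≡q+r = trans (card-⊎ (↔-trans εz (through-splits (claw-zxy K))) Pzx Pzy)
                    (cong₂ _+_ (card-unique Pzx (↔-trans Pxz pair-sym)) (card-unique Pzy (↔-trans Pyz pair-sym)))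
    ; count-p = Pxy }

  uses-third-edge : (K : Claw G v) → let open Claw K in ¬ Pair x y →
    ∀ S {f f'} → IsCycle G g S → (v , f) ∈E S → (v , f') ∈E S → f ≢ f' → f ≡ z ⊎ f' ≡ z
  uses-third-edge K no-xy S C vf vf' f≢f'
    with claw-complete deg≡3 K (cycle-edge-adj G S C vf) | claw-complete deg≡3 K (cycle-edge-adj G S C vf')
  ... | _                | inj₂ (inj₂ f'≡z) = inj₂ f'≡z
  ... | inj₂ (inj₂ f≡z) | _                = inj₁ f≡z
  ... | inj₁ refl        | inj₁ refl        = ⊥-elim (f≢f' refl)
  ... | inj₂ (inj₁ refl) | inj₂ (inj₁ refl) = ⊥-elim (f≢f' refl)
  ... | inj₁ refl        | inj₂ (inj₁ refl) = ⊥-elim (no-xy (gct S C vf , vf'))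
  ... | inj₂ (inj₁ refl) | inj₁ refl        = ⊥-elim (no-xy (gct S C vf' , vf))
    where open Claw K

flips : ℕ → Bool → Bool
flips zero    b = b
flips (suc k) b = not (flips k b)

flips-fixed⇒even : ∀ k b → flips k b ≡ b → 2 ∣ k
flips-fixed⇒even zero          b eq = divides 0 refl
flips-fixed⇒even (suc zero)    false ()
flips-fixed⇒even (suc zero)    true  ()
flips-fixed⇒even (suc (suc k)) b eq =
  ∣m∣n⇒∣m+n ∣-refl (flips-fixed⇒even k b (trans (sym (not-involutive (flips k b))) eq))

alternating⇒even : ∀ {m} (β : Fin (suc m) → Bool) → (∀ i → β (csuc i) ≡ not (β i)) → 2 ∣ suc m
alternating⇒even {m} β flip = flips-fixed⇒even (suc m) (β zero) (sym around)
  where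
    along : ∀ t (t<1+m : t < suc m) → β (fromℕ< t<1+m) ≡ flips t (β zero)
    along zero    _      = refl
    along (suc t) t+1<1+m = trans (cong β (sym step)) (trans (flip (fromℕ< t<1+m)) (cong not (along t t<1+m)))
      where
        t<1+m : t < suc m
        t<1+m = <-trans (n<1+n t) t+1<1+m
        step : csuc (fromℕ< t<1+m) ≡ fromℕ< t+1<1+m
        step = toℕ-injective
          (trans (csuc-step (fromℕ< t<1+m) (subst (_< m) (sym (toℕ-fromℕ< t<1+m)) (s≤s⁻¹ t+1<1+m)))
                 (trans (cong suc (toℕ-fromℕ< t<1+m)) (sym (toℕ-fromℕ< t+1<1+m))))
    last : Fin (suc m)
    last = fromℕ< (n<1+n m)
    around : β zero ≡ flips (suc m) (β zero)
    around = trans (cong β (toℕ-injective (sym (csuc-wrap last (toℕ-fromℕ< (n<1+n m))))))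
                   (trans (flip last) (cong not (along m (n<1+n m))))

cycle-alternating⇒even : ∀ {n} (G : Graph n) {k} S → IsCycle G k S → (M : Fin n → Fin n → Bool) →
  (∀ u v → adj G u v ≡ true → M u v ≡ M v u) →
  (∀ v f f' → f ≢ f' → (v , f) ∈E S → (v , f') ∈E S → M v f ≡ not (M v f')) →
  2 ∣ k
cycle-alternating⇒even G S (s≤s (s≤s (s≤s _)) , w , w-inj , w-adj , edges) M M-sym M-alt =
  alternating⇒even (λ i → M (w i) (w (csuc i))) step
  where
    step : ∀ i → M (w (csuc i)) (w (csuc (csuc i))) ≡ not (M (w i) (w (csuc i)))
    step i = trans
      (M-alt _ _ _ (csuc²≢id (s≤s (s≤s z≤n)) i ∘ w-inj)
             (Equivalence.from (edges _ _) (csuc i , inj₁ (refl , refl)))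
             (Equivalence.from (edges _ _) (i , inj₂ (refl , refl))))
      (cong not (M-sym _ _ (trans (Graph.sym G _ _) (w-adj i))))

pair-sums-even : ∀ {a b c} p q r → a ≡ p + q → b ≡ p + r → c ≡ q + r → 2 ∣ a + b + c
pair-sums-even p q r refl refl refl =
  divides (p + q + r) (solve 3 (λ p q r → (p :+ q) :+ (p :+ r) :+ (q :+ r) := (p :+ q :+ r) :* con 2) refl p q r)
  where open +-*-Solver

pair-sums-triangle : ∀ {a b c} p q r → a ≡ p + q → b ≡ p + r → c ≡ q + r → c ≤ a + b
pair-sums-triangle p q r refl refl refl = +-mono-≤ (m≤n+m q p) (m≤n+m r p)

pair-sums-tight : ∀ {a b c} p q r → a ≡ p + q → b ≡ p + r → c ≡ q + r → c ≡ a + b → p ≡ 0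
pair-sums-tight p q r refl refl refl tight =
  m+n≡0⇒m≡0 p (sym (+-cancelʳ-≡ (q + r) 0 (p + p) (trans tight regroup)))
  where
    open +-*-Solver
    regroup : (p + q) + (p + r) ≡ (p + p) + (q + r)
    regroup = solve 3 (λ p q r → (p :+ q) :+ (p :+ r) := (p :+ p) :+ (q :+ r)) refl p q r

exactly-one : ∀ {n} {f f' z : Fin n} → f ≢ f' → f ≡ z ⊎ f' ≡ z → does (f ≟ z) ≡ not (does (f' ≟ z))
exactly-one {f = f} {f'} {z} f≢f' one with f ≟ z | f' ≟ z
... | yes f≡z | yes f'≡z = ⊥-elim (f≢f' (trans f≡z (sym f'≡z)))
... | yes _   | no _     = refl
... | no _    | yes _    = refl
... | no f≢z  | no f'≢z  = ⊥-elim ([ f≢z , f'≢z ] one)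

does-cong : ∀ {n} {u v u' v' : Fin n} → (u ≡ v → u' ≡ v') → (u' ≡ v' → u ≡ v) → does (u ≟ v) ≡ does (u' ≟ v')
does-cong {u = u} {v} {u'} {v'} ⇒ ⇐ with u ≟ v | u' ≟ v'
... | yes _   | yes _    = refl
... | no _    | no _     = refl
... | yes u≡v | no u'≢v' = ⊥-elim (u'≢v' (⇒ u≡v))
... | no u≢v  | yes u'≡v' = ⊥-elim (u≢v (⇐ u'≡v'))

record Signed {n} (G : Graph n) (g : ℕ) (v : Fin n) (a b c : ℕ) : Set where
  field
    claw : Claw G v
    εx : Eps G g v (Claw.x claw) a
    εy : Eps G g v (Claw.y claw) b
    εz : Eps G g v (Claw.z claw) c

signed : ∀ {n} {G : Graph n} {g v a b c} → HasSignature3 G g v a b c → Signed G g v a b c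
signed (_ , _ , x , y , z , x≢y , x≢z , y≢z , v~x , v~y , v~z , εx , εy , εz) = record
  { claw = record { x = x ; y = y ; z = z ; x≢y = x≢y ; x≢z = x≢z ; y≢z = y≢z
                  ; v~x = v~x ; v~y = v~y ; v~z = v~z }
  ; εx = εx ; εy = εy ; εz = εz }

eps-retarget : ∀ {n} {G : Graph n} {g u t t' k} → Eps G g u t k → t' ≡ t → Eps G g u t' k
eps-retarget ε refl = ε

module GirthRegular {n} (G : Graph n) (g a b c : ℕ) (cubic : Cubic G) (reg : GirthRegular3 G g a b c) where

  module At (v : Fin n) = Signed (signed (reg v))
  open At using (claw)

  LightPair : Fin n → Set
  LightPair v = Star.Pair G g v (cubic v) (Claw.x (claw v)) (Claw.y (claw v))

  counts : ∀ v → PairCounts a b c (LightPair v)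
  counts v = Star.local-counts G g v (cubic v) (claw v) (At.εx v) (At.εy v) (At.εz v)

  module Balanced (1≤a : 1 ≤ a) (c≡a+b : c ≡ a + b) where

    heavy : Fin n → Fin n
    heavy v = Claw.z (claw v)

    -- c = a + b forces p = 0: no girth cycle passes through both light edges at v.
    no-light-pair : ∀ v → ¬ LightPair v
    no-light-pair v xy-cycle = ¬Fin0 (subst Fin p≡0 (Inverse.from count-p xy-cycle))
      where
        open PairCounts (counts v)
        p≡0 : p ≡ 0
        p≡0 = pair-sums-tight p q r a≡p+q b≡p+r c≡q+r c≡a+b

    b<c : b < c
    b<c = subst (b <_) (sym c≡a+b) (+-monoˡ-≤ b 1≤a)

    a<c : Fin n → a < c
    a<c v = ≤-<-trans (proj₁ (reg v)) b<c

    value-c⇒heavy : ∀ {u w} → adj G u w ≡ true → Eps G g u w c → w ≡ heavy u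
    value-c⇒heavy {u} u~w ε with claw-complete (cubic u) (claw u) u~w
    ... | inj₁ w≡xu        = ⊥-elim (<-irrefl (card-unique (eps-retarget (At.εx u) w≡xu) ε) (a<c u))
    ... | inj₂ (inj₁ w≡yu) = ⊥-elim (<-irrefl (card-unique (eps-retarget (At.εy u) w≡yu) ε) b<c)
    ... | inj₂ (inj₂ w≡zu) = w≡zu

    -- Since ε is symmetric, the heavy edge at v is heavy at its other end too:
    -- the heavy edges form a perfect matching.
    heavy-involutive : ∀ {u v} → adj G v u ≡ true → u ≡ heavy v → v ≡ heavy u
    heavy-involutive {u} {v} v~u u≡hv =
      value-c⇒heavy (trans (Graph.sym G u v) v~u) (eps-flip (eps-retarget (At.εz v) u≡hv))

    isHeavy : Fin n → Fin n → Bool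
    isHeavy u v = does (v ≟ heavy u)

    isHeavy-sym : ∀ u v → adj G u v ≡ true → isHeavy u v ≡ isHeavy v u
    isHeavy-sym u v u~v = does-cong (heavy-involutive u~v) (heavy-involutive (trans (Graph.sym G v u) u~v))

    heavy-alternates : ∀ S → IsCycle G g S → ∀ v f f' → f ≢ f' → (v , f) ∈E S → (v , f') ∈E S →
      isHeavy v f ≡ not (isHeavy v f')
    heavy-alternates S C v f f' f≢f' vf vf' =
      exactly-one f≢f' (Star.uses-third-edge G g v (cubic v) (claw v) (no-light-pair v) S C vf vf' f≢f')

    girth-even : ∀ S → IsCycle G g S → 2 ∣ g
    girth-even S C = cycle-alternating⇒even G S C isHeavy isHeavy-sym (heavy-alternates S C)

lemma3p1 : ∀ {n} (G : Graph n) (g a b c : ℕ) →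
    Cubic G → IsGirth G g → GirthRegular3 G g a b c →
    (2 ∣ a + b + c) × (c ≤ a + b) × (1 ≤ a → c ≡ a + b → 2 ∣ g)
lemma3p1 G g a b c cubic ((S₀ , girth-cycle) , _) reg =
    pair-sums-even p q r a≡p+q b≡p+r c≡q+r
  , pair-sums-triangle p q r a≡p+q b≡p+r c≡q+r
  , λ 1≤a c≡a+b → Balanced.girth-even 1≤a c≡a+b S₀ girth-cycle
  where
    open GirthRegular G g a b c cubic reg
    open PairCounts (counts (vertex-on G S₀ girth-cycle))
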